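{- Let $q$ be an odd prime power and let $D,E\in\mathbb{F}_q$. Define $\omega=3D^2-3DE+E^2$ and consider $$f(X)=EX^2+2(E-D)X^{q+1}+2DX^{q^2+1}+(E-D)X^{2q}+DX^{2q^2}.$$ Then $f(X)$ is planar over $\mathbb{F}_{q^3}$ if and only if $E\omega\neq 0$.
   Context: For $q$ odd, a function $f:\mathbb{F}_{q^n}\to\mathbb{F}_{q^n}$ is called planar (over $\mathbb{F}_{q^n}$) if for every $\epsilon\in\mathbb{F}_{q^n}^*$ the polynomial $f(X+\epsilon)-f(X)$ induces a permutation of $\mathbb{F}_{q^n}$. -}

module Defs where

open import Level using (0ℓ)
open import Data.Nat as ℕ using (ℕ; zero; suc)
open import Data.Nat.Primality using (Prime)
open import Data.Nat.Divisibility using (_∣_)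
open import Data.Fin using (Fin)
open import Data.Product using (Σ; ∃; ∃-syntax; _×_)
open import Relation.Binary.PropositionalEquality using (_≡_; _≢_)
open import Relation.Nullary using (¬_)
open import Algebra.Structures using (IsCommutativeRing)
open import Function.Bundles using (_↔_)
open import Function.Definitions using (Bijective)

OddPrimePower : ℕ → Set
OddPrimePower q = ∃[ p ] ∃[ k ] (Prime p × q ≡ p ℕ.^ suc k × ¬ (2 ∣ q))

record FiniteField : Set₁ where
  infixl 7 _*_
  infixl 6 _+_ _-_
  field
    Carrier : Set
    _+_ _*_ : Carrier → Carrier → Carrier
    -_ : Carrier → Carrier
    0# 1# : Carrier
    isCommutativeRing : IsCommutativeRing _≡_ _+_ _*_ -_ 0# 1#
    0≢1 : 0# ≢ 1#
    inverse : ∀ x → x ≢ 0# → ∃[ y ] (x * y ≡ 1#)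
    size : ℕ
    enumeration : Carrier ↔ Fin size

  _-_ : Carrier → Carrier → Carrier
  x - y = x + (- y)

  infixr 8 _^_
  _^_ : Carrier → ℕ → Carrier
  x ^ zero = 1#
  x ^ suc n = x * (x ^ n)

  fromℕ : ℕ → Carrier
  fromℕ zero = 0#
  fromℕ (suc n) = 1# + fromℕ n

  Planar : (Carrier → Carrier) → Set
  Planar f = ∀ ε → ε ≢ 0# → Bijective _≡_ _≡_ (λ x → f (x + ε) - f x)

module _ (L : FiniteField) where
  open FiniteField L

  ω : Carrier → Carrier → Carrier
  ω D E = fromℕ 3 * D ^ 2 - fromℕ 3 * D * E + E ^ 2

  fPoly : ℕ → Carrier → Carrier → Carrier → Carrier
  fPoly q D E X =
    E * X ^ 2
    + fromℕ 2 * (E - D) * X ^ (q ℕ.+ 1)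
    + fromℕ 2 * D * X ^ (q ℕ.^ 2 ℕ.+ 1)
    + (E - D) * X ^ (2 ℕ.* q)
    + D * X ^ (2 ℕ.* q ℕ.^ 2)

{-# OPTIONS --safe #-}
module Submission where

-- σ x = x ^ q is a field automorphism of order 3 fixing D and E.  With T x = x + σ x and the
-- additive map Λ t = (E − D) t + D σ²t one has f x = Λ (T x · T x), hence
-- f (x + ε) − f x = 2 Λ (T x · T ε) + f ε.  As T and multiplication by T ε ≠ 0 are injective,
-- f is planar iff Λ has trivial kernel.  Applying σ, Λ t = 0 becomes (D − E) σt = D t.  Taking
-- norms, a solution t ≠ 0 forces (D − E)³ = D³, i.e. E ω = (E − D)³ + D³ = 0.  Conversely, if
-- r = D / (D − E) is a cube root of unity then t = z + r² σz + r σ²z satisfies σt = r t, and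
-- t ≠ 0 for z = w or z = w² whenever σ w ≠ w.

open import Defs

open import Level using (0ℓ)
open import Algebra.Bundles using (CommutativeRing)
open import Algebra.Solver.Ring.AlmostCommutativeRing using (fromCommutativeRing; _-Raw-AlmostCommutative⟶_)
import Algebra.Solver.Ring
import Algebra.Properties.AbelianGroup
import Algebra.Properties.CommutativeMonoid.Sum
import Algebra.Properties.CommutativeSemigroup
import Algebra.Properties.CommutativeSemiring.Binomial
import Algebra.Properties.CommutativeSemiring.Exp
import Algebra.Properties.Group
import Algebra.Properties.Ring
import Algebra.Properties.Semiring.Mult
open import Data.Fin as Fin using (Fin)
import Data.Fin.Properties as Fin
open import Data.Fin.Permutation as Perm using (Permutation; _⟨$⟩ʳ_)
open import Data.Integer as ℤ using (ℤ; -[1+_]; _⊖_)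
import Data.Integer.Properties as ℤ
open import Data.List using (List; []; _∷_; length; replicate)
import Data.List.Properties as List
import Data.Maybe as Maybe
open import Data.Nat as ℕ using (ℕ; zero; suc; _!)
import Data.Nat.Properties as ℕ
open import Data.Nat.Properties using (_!*_!≢0)
open import Data.Nat.Combinatorics using (_C_; k![n∸k]!∣n!; nCn≡1)
open import Data.Nat.Combinatorics.Specification using (nCk≡n!/k![n-k]!)
open import Data.Nat.Divisibility using (_∣_; _∤_; divides; m∣m*n; ∣⇒≤; ∣1⇒≡1; m%n≡0⇒n∣m)
open import Data.Nat.DivMod using (_%_; _/_; m/n*n≡m; m≡m%n+[m/n]*n; m%n<n)
open import Data.Nat.Primality using (Prime; prime⇒nonTrivial; euclidsLemma)
open import Data.Product using (∃; ∃-syntax; _,_; proj₁; proj₂)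
open import Data.Sum using (_⊎_; inj₁; inj₂)
import Data.Vec.Functional as Vec
open import Function using (_∘_; _↔_; mk↔ₛ′)
open import Function.Bundles using (Inverse; Injection; Equivalence; _⇔_; mk⇔)
open import Function.Consequences.Propositional using (strictlySurjective⇒surjective)
open import Function.Definitions using (Injective; StrictlySurjective)
open import Function.Properties.Equivalence using () renaming (trans to ⇔-trans)
open import Function.Properties.Inverse using (↔⇒↣; ↔-sym; ↔-trans)
open import Relation.Binary.Definitions using (DecidableEquality)
open import Relation.Binary.PropositionalEquality as ≡ using (_≡_; _≢_; cong; cong₂)
open import Relation.Nullary using (¬_; yes; no; contradiction; dec⇒maybe)
open import Relation.Nullary.Decidable using (via-injection; decidable-stable)

-- The ring solver over an arbitrary commutative ring, with integer coefficients read as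
-- n × 1#.  On a numeral this reduces to the same term as FiniteField.fromℕ, so the solver
-- constant con (ℤ.+ 3) is definitionally fromℕ 3; note that con (ℤ.+ 1) is 1# + 0#, not 1#.
module IntegerCoefficients (R : CommutativeRing 0ℓ 0ℓ) where

  open CommutativeRing R

  private
    open import Data.Integer.Base using (+_)
    open Algebra.Properties.Semiring.Mult semiring using (_×_; ×-homo-+; ×1-homo-*)
    open Algebra.Properties.Ring ring using (-‿involutive; -0#≈0#; -‿distribˡ-*; -‿distribʳ-*)
    open Algebra.Properties.AbelianGroup +-abelianGroup using (⁻¹-∙-comm)
    open Algebra.Properties.CommutativeSemigroup +-commutativeSemigroup using (interchange)
    open import Relation.Binary.Reasoning.Setoid setoid

    ⟦_⟧ : ℤ → Carrier
    ⟦ + n ⟧      = n × 1#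
    ⟦ -[1+ n ] ⟧ = - (suc n × 1#)

    ⟦-⟧ : ∀ i → ⟦ ℤ.- i ⟧ ≈ - ⟦ i ⟧
    ⟦-⟧ -[1+ n ]  = sym (-‿involutive _)
    ⟦-⟧ (+ zero)  = sym -0#≈0#
    ⟦-⟧ (+ suc n) = refl

    1+x-[1+y]≈x-y : ∀ x y → (1# + x) - (1# + y) ≈ x - y
    1+x-[1+y]≈x-y x y = begin
      (1# + x) + - (1# + y)     ≈⟨ +-congˡ (⁻¹-∙-comm 1# y) ⟨
      (1# + x) + (- 1# + - y)   ≈⟨ interchange 1# x (- 1#) (- y) ⟩
      (1# - 1#) + (x - y)       ≈⟨ +-congʳ (-‿inverseʳ 1#) ⟩
      0# + (x - y)              ≈⟨ +-identityˡ _ ⟩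
      x - y                     ∎

    ⟦⊖⟧ : ∀ m n → ⟦ m ⊖ n ⟧ ≈ m × 1# - n × 1#
    ⟦⊖⟧ zero    zero    = sym (-‿inverseʳ 0#)
    ⟦⊖⟧ zero    (suc n) = sym (+-identityˡ _)
    ⟦⊖⟧ (suc m) zero    = sym (trans (+-congˡ -0#≈0#) (+-identityʳ _))
    ⟦⊖⟧ (suc m) (suc n) = begin
      ⟦ suc m ⊖ suc n ⟧          ≡⟨ cong ⟦_⟧ (ℤ.[1+m]⊖[1+n]≡m⊖n m n) ⟩
      ⟦ m ⊖ n ⟧                  ≈⟨ ⟦⊖⟧ m n ⟩
      m × 1# - n × 1#            ≈⟨ 1+x-[1+y]≈x-y _ _ ⟨
      suc m × 1# - suc n × 1#    ∎

    ⟦+⟧ : ∀ i j → ⟦ i ℤ.+ j ⟧ ≈ ⟦ i ⟧ + ⟦ j ⟧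
    ⟦+⟧ (+ m)    (+ n)    = ×-homo-+ 1# m n
    ⟦+⟧ (+ m)    -[1+ n ] = ⟦⊖⟧ m (suc n)
    ⟦+⟧ -[1+ m ] (+ n)    = trans (⟦⊖⟧ n (suc m)) (+-comm _ _)
    ⟦+⟧ -[1+ m ] -[1+ n ] = begin
      - (suc (suc (m ℕ.+ n)) × 1#)   ≡⟨ cong (λ k → - (suc k × 1#)) (ℕ.+-suc m n) ⟨
      - ((suc m ℕ.+ suc n) × 1#)     ≈⟨ -‿cong (×-homo-+ 1# (suc m) (suc n)) ⟩
      - (suc m × 1# + suc n × 1#)    ≈⟨ ⁻¹-∙-comm _ _ ⟨
      ⟦ -[1+ m ] ⟧ + ⟦ -[1+ n ] ⟧    ∎

    ⟦*+⟧ : ∀ i n → ⟦ i ℤ.* + n ⟧ ≈ ⟦ i ⟧ * (n × 1#)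
    ⟦*+⟧ (+ m)    n = trans (reflexive (cong ⟦_⟧ (≡.sym (ℤ.pos-* m n)))) (×1-homo-* m n)
    ⟦*+⟧ -[1+ m ] n = begin
      ⟦ -[1+ m ] ℤ.* + n ⟧         ≡⟨ cong ⟦_⟧ (ℤ.neg-distribˡ-* (+ suc m) (+ n)) ⟨
      ⟦ ℤ.- (+ suc m ℤ.* + n) ⟧    ≈⟨ ⟦-⟧ (+ suc m ℤ.* + n) ⟩
      - ⟦ + suc m ℤ.* + n ⟧        ≈⟨ -‿cong (⟦*+⟧ (+ suc m) n) ⟩
      - (suc m × 1# * (n × 1#))    ≈⟨ -‿distribˡ-* _ _ ⟩
      ⟦ -[1+ m ] ⟧ * (n × 1#)      ∎

    ⟦*⟧ : ∀ i j → ⟦ i ℤ.* j ⟧ ≈ ⟦ i ⟧ * ⟦ j ⟧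
    ⟦*⟧ i (+ n)    = ⟦*+⟧ i n
    ⟦*⟧ i -[1+ n ] = begin
      ⟦ i ℤ.* -[1+ n ] ⟧           ≡⟨ cong ⟦_⟧ (ℤ.neg-distribʳ-* i (+ suc n)) ⟨
      ⟦ ℤ.- (i ℤ.* + suc n) ⟧      ≈⟨ ⟦-⟧ (i ℤ.* + suc n) ⟩
      - ⟦ i ℤ.* + suc n ⟧          ≈⟨ -‿cong (⟦*+⟧ i (suc n)) ⟩
      - (⟦ i ⟧ * (suc n × 1#))     ≈⟨ -‿distribʳ-* _ _ ⟩
      ⟦ i ⟧ * ⟦ -[1+ n ] ⟧         ∎

    homomorphism : ℤ.+-*-rawRing -Raw-AlmostCommutative⟶ fromCommutativeRing R
    homomorphism = record
      { ⟦_⟧ = ⟦_⟧ ; +-homo = ⟦+⟧ ; *-homo = ⟦*⟧ ; -‿homo = ⟦-⟧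
      ; 0-homo = refl ; 1-homo = +-identityʳ 1# }

    ⟦⟧-reflects-≟ : ∀ i j → Maybe.Maybe (⟦ i ⟧ ≈ ⟦ j ⟧)
    ⟦⟧-reflects-≟ i j = Maybe.map (reflexive ∘ cong ⟦_⟧) (dec⇒maybe (i ℤ.≟ j))

  open Algebra.Solver.Ring ℤ.+-*-rawRing (fromCommutativeRing R) homomorphism ⟦⟧-reflects-≟ public

finInjective⇒surjective : ∀ {n} {f : Fin n → Fin n} → Injective _≡_ _≡_ f → StrictlySurjective _≡_ f
finInjective⇒surjective {suc n} {f} f-injective y with Fin.any? (λ x → f x Fin.≟ y)
... | yes hit = hit
... | no miss = contradiction (Fin.injective⇒≤ f′-injective) ℕ.1+n≰n
  where
  y≢f : ∀ x → y ≢ f x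
  y≢f x y≡fx = miss (x , ≡.sym y≡fx)
  f′ : Fin (suc n) → Fin n
  f′ x = Fin.punchOut (y≢f x)
  f′-injective : Injective _≡_ _≡_ f′
  f′-injective f′x≡f′z = f-injective (Fin.punchOut-injective (y≢f _) (y≢f _) f′x≡f′z)

module _ {p} (p-prime : Prime p) where

  1<p : 1 ℕ.< p
  1<p = ℕ.nonTrivial⇒n>1 p {{prime⇒nonTrivial p-prime}}

  p∤m! : ∀ {m} → m ℕ.< p → p ∤ m !
  p∤m! {zero}  _   p∣1 = ℕ.<⇒≢ 1<p (≡.sym (∣1⇒≡1 p∣1))
  p∤m! {suc m} m<p p∣m! with euclidsLemma (suc m) (m !) p-prime p∣m!
  ... | inj₁ p∣1+m = ℕ.<⇒≱ m<p (∣⇒≤ p∣1+m)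
  ... | inj₂ p∣m!  = p∤m! (ℕ.<-trans (ℕ.n<1+n m) m<p) p∣m!

  -- p divides p ! = (p C k) * (k ! * (p ∸ k) !) but neither k ! nor (p ∸ k) !.
  p∣pCk : ∀ {k} → 0 ℕ.< k → k ℕ.< p → p ∣ p C k
  p∣pCk {k} 0<k k<p with euclidsLemma (p C k) (k ! ℕ.* (p ℕ.∸ k) !) p-prime p∣pCk*k![p∸k]!
    where
    instance _ = k !* (p ℕ.∸ k) !≢0
    pCk*k![p∸k]!≡p! : (p C k) ℕ.* (k ! ℕ.* (p ℕ.∸ k) !) ≡ p !
    pCk*k![p∸k]!≡p! = ≡.trans (cong (ℕ._* (k ! ℕ.* (p ℕ.∸ k) !)) (nCk≡n!/k![n-k]! (ℕ.<⇒≤ k<p)))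
                              (m/n*n≡m (k![n∸k]!∣n! (ℕ.<⇒≤ k<p)))
    p∣p! : ∀ n → 1 ℕ.< n → n ∣ n !
    p∣p! (suc n) _ = m∣m*n (n !)
    p∣pCk*k![p∸k]! : p ∣ (p C k) ℕ.* (k ! ℕ.* (p ℕ.∸ k) !)
    p∣pCk*k![p∸k]! = ≡.subst (p ∣_) (≡.sym pCk*k![p∸k]!≡p!) (p∣p! p 1<p)
  ... | inj₁ p∣pCk = p∣pCk
  ... | inj₂ p∣k!*[p∸k]! with euclidsLemma (k !) ((p ℕ.∸ k) !) p-prime p∣k!*[p∸k]!
  ...   | inj₁ p∣k!     = contradiction p∣k! (p∤m! k<p)
  ...   | inj₂ p∣[p∸k]! = contradiction p∣[p∸k]! (p∤m! (ℕ.∸-monoʳ-< 0<k (ℕ.<⇒≤ k<p)))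

module FieldProperties (L : FiniteField) where

  open FiniteField L public

  commutativeRing : CommutativeRing 0ℓ 0ℓ
  commutativeRing = record { isCommutativeRing = isCommutativeRing }

  open CommutativeRing commutativeRing public
    using ( +-comm; +-identityˡ; +-identityʳ; -‿inverseʳ
          ; *-assoc; *-comm; *-identityˡ; *-identityʳ; zeroˡ; zeroʳ; distribʳ
          ; ring; semiring; commutativeSemiring; +-group; +-commutativeMonoid; *-commutativeMonoid )
  open IntegerCoefficients commutativeRing public using (solve; _:=_; _:+_; _:*_; _:-_; :-_; _:^_; con)
  open Algebra.Properties.Ring ring public using (-‿involutive; -0#≈0#)
  open Algebra.Properties.Group +-group public using ()
    renaming ( ∙-cancelˡ to +-cancelˡ; ∙-cancelʳ to +-cancelʳ
             ; x∙y⁻¹≈ε⇒x≈y to x-y≡0⇒x≡y; x≈y⇒x∙y⁻¹≈ε to x≡y⇒x-y≡0 )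

  private
    module Exp = Algebra.Properties.CommutativeSemiring.Exp commutativeSemiring
    module Mult = Algebra.Properties.Semiring.Mult semiring
    module ∑ = Algebra.Properties.CommutativeMonoid.Sum +-commutativeMonoid
    module ∏ = Algebra.Properties.CommutativeMonoid.Sum *-commutativeMonoid
    module Binomial = Algebra.Properties.CommutativeSemiring.Binomial commutativeSemiring
    open ≡.≡-Reasoning

    enc : Carrier → Fin size
    enc = Inverse.to enumeration
    dec : Fin size → Carrier
    dec = Inverse.from enumeration
    dec∘enc : ∀ x → dec (enc x) ≡ x
    dec∘enc = Inverse.strictlyInverseʳ enumeration
    enc-injective : Injective _≡_ _≡_ enc
    enc-injective = Injection.injective (↔⇒↣ enumeration)
    dec-injective : Injective _≡_ _≡_ dec
    dec-injective = Injection.injective (↔⇒↣ (↔-sym enumeration))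

  infix 4 _≟_
  _≟_ : DecidableEquality Carrier
  _≟_ = via-injection (↔⇒↣ enumeration) Fin._≟_

  1≢0 : 1# ≢ 0#
  1≢0 1≡0 = 0≢1 (≡.sym 1≡0)

  module _ {x x⁻¹} (xx⁻¹≡1 : x * x⁻¹ ≡ 1#) where

    x⁻¹*[x*y]≡y : ∀ y → x⁻¹ * (x * y) ≡ y
    x⁻¹*[x*y]≡y y = begin
      x⁻¹ * (x * y)   ≡⟨ solve 3 (λ i x y → i :* (x :* y) := (x :* i) :* y) ≡.refl x⁻¹ x y ⟩
      (x * x⁻¹) * y   ≡⟨ cong (_* y) xx⁻¹≡1 ⟩
      1# * y          ≡⟨ *-identityˡ y ⟩
      y               ∎

    x*[x⁻¹*y]≡y : ∀ y → x * (x⁻¹ * y) ≡ y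
    x*[x⁻¹*y]≡y y = begin
      x * (x⁻¹ * y)   ≡⟨ *-assoc x x⁻¹ y ⟨
      (x * x⁻¹) * y   ≡⟨ cong (_* y) xx⁻¹≡1 ⟩
      1# * y          ≡⟨ *-identityˡ y ⟩
      y               ∎

  *-cancelˡ : ∀ {x y z} → x ≢ 0# → x * y ≡ x * z → y ≡ z
  *-cancelˡ {x} {y} {z} x≢0 xy≡xz = begin
    y               ≡⟨ x⁻¹*[x*y]≡y xx⁻¹≡1 y ⟨
    x⁻¹ * (x * y)   ≡⟨ cong (x⁻¹ *_) xy≡xz ⟩
    x⁻¹ * (x * z)   ≡⟨ x⁻¹*[x*y]≡y xx⁻¹≡1 z ⟩
    z               ∎
    where
    x⁻¹ = proj₁ (inverse x x≢0)
    xx⁻¹≡1 : x * x⁻¹ ≡ 1#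
    xx⁻¹≡1 = proj₂ (inverse x x≢0)

  *-cancelʳ : ∀ {x y z} → z ≢ 0# → x * z ≡ y * z → x ≡ y
  *-cancelʳ {x} {y} {z} z≢0 xz≡yz = *-cancelˡ z≢0 (≡.trans (*-comm z x) (≡.trans xz≡yz (*-comm y z)))

  x≢0∧x*y≡0⇒y≡0 : ∀ {x y} → x ≢ 0# → x * y ≡ 0# → y ≡ 0#
  x≢0∧x*y≡0⇒y≡0 {x} x≢0 xy≡0 = *-cancelˡ x≢0 (≡.trans xy≡0 (≡.sym (zeroʳ x)))

  x*y≡0⇒x≡0⊎y≡0 : ∀ {x y} → x * y ≡ 0# → x ≡ 0# ⊎ y ≡ 0#
  x*y≡0⇒x≡0⊎y≡0 {x} xy≡0 with x ≟ 0#
  ... | yes x≡0 = inj₁ x≡0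
  ... | no x≢0  = inj₂ (x≢0∧x*y≡0⇒y≡0 x≢0 xy≡0)

  *-≢0 : ∀ {x y} → x ≢ 0# → y ≢ 0# → x * y ≢ 0#
  *-≢0 x≢0 y≢0 xy≡0 = y≢0 (x≢0∧x*y≡0⇒y≡0 x≢0 xy≡0)

  x*x≡0⇒x≡0 : ∀ {x} → x * x ≡ 0# → x ≡ 0#
  x*x≡0⇒x≡0 {x} xx≡0 = decidable-stable (x ≟ 0#) (λ x≢0 → *-≢0 x≢0 x≢0 xx≡0)

  x^n≡0⇒x≡0 : ∀ {x} n → x ^ n ≡ 0# → x ≡ 0#
  x^n≡0⇒x≡0 zero    1≡0   = contradiction 1≡0 1≢0
  x^n≡0⇒x≡0 (suc n) xxⁿ≡0 with x*y≡0⇒x≡0⊎y≡0 xxⁿ≡0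
  ... | inj₁ x≡0  = x≡0
  ... | inj₂ xⁿ≡0 = x^n≡0⇒x≡0 n xⁿ≡0

  [-a]³≡b³⇔a³+b³≡0 : ∀ a b → (- a) ^ 3 ≡ b ^ 3 ⇔ a ^ 3 + b ^ 3 ≡ 0#
  [-a]³≡b³⇔a³+b³≡0 a b = mk⇔
    (λ [-a]³≡b³ → begin
      a ^ 3 + b ^ 3            ≡⟨ -‿involutive _ ⟨
      - - (a ^ 3 + b ^ 3)      ≡⟨ cong -_ [-a]³-b³≡-[a³+b³] ⟨
      - ((- a) ^ 3 - b ^ 3)    ≡⟨ cong -_ (x≡y⇒x-y≡0 [-a]³≡b³) ⟩
      - 0#                     ≡⟨ -0#≈0# ⟩
      0#                       ∎)
    (λ a³+b³≡0 → x-y≡0⇒x≡y _ _ (≡.trans [-a]³-b³≡-[a³+b³] (≡.trans (cong -_ a³+b³≡0) -0#≈0#)))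
    where
    [-a]³-b³≡-[a³+b³] : (- a) ^ 3 - b ^ 3 ≡ - (a ^ 3 + b ^ 3)
    [-a]³-b³≡-[a³+b³] = solve 2 (λ a b → (:- a) :^ 3 :- b :^ 3 := :- (a :^ 3 :+ b :^ 3)) ≡.refl a b

  E*ω≡[E-D]³+D³ : ∀ D E → E * ω L D E ≡ (E - D) ^ 3 + D ^ 3
  E*ω≡[E-D]³+D³ D E = solve 2
    (λ D E → E :* (con (ℤ.+ 3) :* D :^ 2 :- con (ℤ.+ 3) :* D :* E :+ E :^ 2) := (E :- D) :^ 3 :+ D :^ 3)
    ≡.refl D E

  Additive : (Carrier → Carrier) → Set
  Additive φ = ∀ x y → φ (x + y) ≡ φ x + φ y

  TrivialKernel : (Carrier → Carrier) → Set
  TrivialKernel φ = ∀ x → φ x ≡ 0# → x ≡ 0#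

  additive∧trivialKernel⇒injective : ∀ {φ} → Additive φ → TrivialKernel φ → Injective _≡_ _≡_ φ
  additive∧trivialKernel⇒injective {φ} φ-+ kernel {x} {y} φx≡φy =
    x-y≡0⇒x≡y x y (kernel (x - y) (+-cancelʳ (φ y) _ _ (begin
      φ (x - y) + φ y    ≡⟨ φ-+ (x - y) y ⟨
      φ (x - y + y)      ≡⟨ cong φ (solve 2 (λ x y → x :- y :+ y := x) ≡.refl x y) ⟩
      φ x                ≡⟨ φx≡φy ⟩
      φ y                ≡⟨ +-identityˡ (φ y) ⟨
      0# + φ y           ∎)))

  ^≡Exp^ : ∀ x n → x ^ n ≡ x Exp.^ n
  ^≡Exp^ x zero    = ≡.refl
  ^≡Exp^ x (suc n) = cong (x *_) (^≡Exp^ x n)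

  ^-+ : ∀ x m n → x ^ (m ℕ.+ n) ≡ x ^ m * x ^ n
  ^-+ x m n = begin
    x ^ (m ℕ.+ n)          ≡⟨ ^≡Exp^ x (m ℕ.+ n) ⟩
    x Exp.^ (m ℕ.+ n)      ≡⟨ Exp.^-homo-* x m n ⟩
    x Exp.^ m * x Exp.^ n  ≡⟨ cong₂ _*_ (^≡Exp^ x m) (^≡Exp^ x n) ⟨
    x ^ m * x ^ n          ∎

  ^-* : ∀ x m n → x ^ (m ℕ.* n) ≡ (x ^ m) ^ n
  ^-* x m n = begin
    x ^ (m ℕ.* n)          ≡⟨ ^≡Exp^ x (m ℕ.* n) ⟩
    x Exp.^ (m ℕ.* n)      ≡⟨ Exp.^-assocʳ x m n ⟨
    (x Exp.^ m) Exp.^ n    ≡⟨ cong (Exp._^ n) (^≡Exp^ x m) ⟨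
    (x ^ m) Exp.^ n        ≡⟨ ^≡Exp^ (x ^ m) n ⟨
    (x ^ m) ^ n            ∎

  *-^ : ∀ x y n → (x * y) ^ n ≡ x ^ n * y ^ n
  *-^ x y n = begin
    (x * y) ^ n            ≡⟨ ^≡Exp^ (x * y) n ⟩
    (x * y) Exp.^ n        ≡⟨ Exp.^-distrib-* x y n ⟩
    x Exp.^ n * y Exp.^ n  ≡⟨ cong₂ _*_ (^≡Exp^ x n) (^≡Exp^ y n) ⟨
    x ^ n * y ^ n          ∎

  fromℕ≡×1 : ∀ n → fromℕ n ≡ n Mult.× 1#
  fromℕ≡×1 zero    = ≡.refl
  fromℕ≡×1 (suc n) = cong (1# +_) (fromℕ≡×1 n)

  fromℕ-+ : ∀ m n → fromℕ (m ℕ.+ n) ≡ fromℕ m + fromℕ n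
  fromℕ-+ m n = begin
    fromℕ (m ℕ.+ n)             ≡⟨ fromℕ≡×1 (m ℕ.+ n) ⟩
    (m ℕ.+ n) Mult.× 1#         ≡⟨ Mult.×-homo-+ 1# m n ⟩
    m Mult.× 1# + n Mult.× 1#   ≡⟨ cong₂ _+_ (fromℕ≡×1 m) (fromℕ≡×1 n) ⟨
    fromℕ m + fromℕ n           ∎

  fromℕ-* : ∀ m n → fromℕ (m ℕ.* n) ≡ fromℕ m * fromℕ n
  fromℕ-* m n = begin
    fromℕ (m ℕ.* n)             ≡⟨ fromℕ≡×1 (m ℕ.* n) ⟩
    (m ℕ.* n) Mult.× 1#         ≡⟨ Mult.×1-homo-* m n ⟩
    m Mult.× 1# * n Mult.× 1#   ≡⟨ cong₂ _*_ (fromℕ≡×1 m) (fromℕ≡×1 n) ⟨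
    fromℕ m * fromℕ n           ∎

  fromℕ-^ : ∀ m n → fromℕ (m ℕ.^ n) ≡ fromℕ m ^ n
  fromℕ-^ m zero    = +-identityʳ 1#
  fromℕ-^ m (suc n) = ≡.trans (fromℕ-* m (m ℕ.^ n)) (cong (fromℕ m *_) (fromℕ-^ m n))

  odd-characteristic⇒2≢0 : ∀ {n} → 2 ∤ n → fromℕ n ≡ 0# → fromℕ 2 ≢ 0#
  odd-characteristic⇒2≢0 {n} 2∤n n≡0 2≡0 with n % 2 in n%2≡r | m%n<n n 2
  ... | 0           | _ = 2∤n (m%n≡0⇒n∣m n 2 n%2≡r)
  ... | suc (suc _) | ℕ.s≤s (ℕ.s≤s ())
  ... | 1           | _ = 1≢0 (begin
    1#                                   ≡⟨ solve 2 (λ o h → o := o :+ con (ℤ.+ 0) :+ h :* con (ℤ.+ 0))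
                                                    ≡.refl 1# (fromℕ (n / 2)) ⟩
    fromℕ 1 + fromℕ (n / 2) * 0#         ≡⟨ cong (λ z → fromℕ 1 + fromℕ (n / 2) * z) 2≡0 ⟨
    fromℕ 1 + fromℕ (n / 2) * fromℕ 2    ≡⟨ cong (fromℕ 1 +_) (fromℕ-* (n / 2) 2) ⟨
    fromℕ 1 + fromℕ (n / 2 ℕ.* 2)        ≡⟨ fromℕ-+ 1 (n / 2 ℕ.* 2) ⟨
    fromℕ (1 ℕ.+ n / 2 ℕ.* 2)            ≡⟨ cong (λ r → fromℕ (r ℕ.+ n / 2 ℕ.* 2)) n%2≡r ⟨
    fromℕ (n % 2 ℕ.+ n / 2 ℕ.* 2)        ≡⟨ cong fromℕ (m≡m%n+[m/n]*n n 2) ⟨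
    fromℕ n                              ≡⟨ n≡0 ⟩
    0#                                   ∎)

  private
    permutationOf : ∀ {n} (e : Carrier ↔ Fin n) (g h : Carrier → Carrier) →
                    (∀ x → g (h x) ≡ x) → (∀ x → h (g x) ≡ x) → Permutation n n
    permutationOf e g h g∘h h∘g = ↔-trans (↔-sym e) (↔-trans (mk↔ₛ′ g h g∘h h∘g) e)

  fromℕ-size≡0 : fromℕ size ≡ 0#
  fromℕ-size≡0 = ≡.sym (+-cancelˡ S 0# (fromℕ size) (begin
    S + 0#                              ≡⟨ +-identityʳ S ⟩
    S                                   ≡⟨ ∑.∑-permute dec shift ⟩
    ∑.sum (λ i → dec (shift ⟨$⟩ʳ i))    ≡⟨ ∑.sum-cong-≗ (λ i → dec∘enc (dec i + 1#)) ⟩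
    ∑.sum (λ i → dec i + 1#)            ≡⟨ ∑.∑-distrib-+ dec (λ _ → 1#) ⟩
    S + ∑.sum {size} (λ _ → 1#)         ≡⟨ cong (S +_) (∑.sum-replicate size) ⟩
    S + size Mult.× 1#                  ≡⟨ cong (S +_) (fromℕ≡×1 size) ⟨
    S + fromℕ size                      ∎))
    where
    S = ∑.sum dec
    shift : Permutation size size
    shift = permutationOf enumeration (_+ 1#) (_- 1#)
      (λ x → solve 2 (λ x y → x :- y :+ y := x) ≡.refl x 1#)
      (λ x → solve 2 (λ x y → x :+ y :- y := x) ≡.refl x 1#)

  ∏-scale : ∀ {n} a (f : Fin n → Carrier) → ∏.sum (λ j → a * f j) ≡ a ^ n * ∏.sum f
  ∏-scale {n} a f = begin
    ∏.sum (λ j → a * f j)            ≡⟨ ∏.∑-distrib-+ (λ _ → a) f ⟩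
    ∏.sum {n} (λ _ → a) * ∏.sum f    ≡⟨ cong (_* ∏.sum f) (∏.sum-replicate n) ⟩
    a Exp.^ n * ∏.sum f              ≡⟨ cong (_* ∏.sum f) (^≡Exp^ a n) ⟨
    a ^ n * ∏.sum f                  ∎

  ∏-≢0 : ∀ {n} (f : Fin n → Carrier) → (∀ j → f j ≢ 0#) → ∏.sum f ≢ 0#
  ∏-≢0 {zero}  f f≢0 = 1≢0
  ∏-≢0 {suc n} f f≢0 = *-≢0 (f≢0 Fin.zero) (∏-≢0 (f ∘ Fin.suc) (f≢0 ∘ Fin.suc))

  -- Multiplication by a ≢ 0 permutes the nonzero elements, whose product P thus satisfies a ^ M * P ≡ P.
  private
    ^-order : ∀ {M} (e : Carrier ↔ Fin (suc M)) {a} → a ≢ 0# → a ^ M ≡ 1#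
    ^-order {M} e {a} a≢0 = *-cancelˡ (∏-≢0 G G≢0) (begin
      P * a ^ M                       ≡⟨ *-comm P _ ⟩
      a ^ M * P                       ≡⟨ ∏-scale a G ⟨
      ∏.sum (λ j → a * G j)           ≡⟨ ∏.sum-cong-≗ aG≡G∘π₀ ⟩
      ∏.sum (λ j → G (π₀ ⟨$⟩ʳ j))     ≡⟨ ∏.∑-permute G π₀ ⟨
      P                               ≡⟨ *-identityʳ P ⟨
      P * 1#                          ∎)
      where
      a⁻¹ = proj₁ (inverse a a≢0)
      aa⁻¹≡1 : a * a⁻¹ ≡ 1#
      aa⁻¹≡1 = proj₂ (inverse a a≢0)
      π : Permutation (suc M) (suc M)
      π = permutationOf e (a *_) (a⁻¹ *_) (x*[x⁻¹*y]≡y aa⁻¹≡1) (x⁻¹*[x*y]≡y aa⁻¹≡1)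
      i₀ = Inverse.to e 0#
      πi₀≡i₀ : π ⟨$⟩ʳ i₀ ≡ i₀
      πi₀≡i₀ = cong (Inverse.to e) (≡.trans (cong (a *_) (Inverse.strictlyInverseʳ e 0#)) (zeroʳ a))
      π₀ : Permutation M M
      π₀ = Perm.remove i₀ π
      G : Fin M → Carrier
      G j = Inverse.from e (Fin.punchIn i₀ j)
      G≢0 : ∀ j → G j ≢ 0#
      G≢0 j Gj≡0 = Fin.punchInᵢ≢i i₀ j (≡.trans (≡.sym (Inverse.strictlyInverseˡ e _)) (cong (Inverse.to e) Gj≡0))
      P = ∏.sum G
      aG≡G∘π₀ : ∀ j → a * G j ≡ G (π₀ ⟨$⟩ʳ j)
      aG≡G∘π₀ j = begin
        a * G j                                                ≡⟨ Inverse.strictlyInverseʳ e _ ⟨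
        Inverse.from e (π ⟨$⟩ʳ Fin.punchIn i₀ j)               ≡⟨ cong (Inverse.from e) (Perm.punchIn-permute π i₀ j) ⟩
        Inverse.from e (Fin.punchIn (π ⟨$⟩ʳ i₀) (π₀ ⟨$⟩ʳ j))   ≡⟨ cong (λ i → G′ (Fin.punchIn i (π₀ ⟨$⟩ʳ j))) πi₀≡i₀ ⟩
        G (π₀ ⟨$⟩ʳ j)                                          ∎
        where G′ = Inverse.from e

  ^-size : ∀ x → x ^ size ≡ x
  ^-size x = go enumeration
    where
    go : ∀ {n} → Carrier ↔ Fin n → x ^ n ≡ x
    go {zero}  e = contradiction (Inverse.to e x) Fin.¬Fin0
    go {suc M} e with x ≟ 0#
    ... | yes ≡.refl = zeroˡ _
    ... | no x≢0     = ≡.trans (cong (x *_) (^-order e x≢0)) (*-identityʳ x)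

  injective⇒surjective : ∀ {f : Carrier → Carrier} → Injective _≡_ _≡_ f → StrictlySurjective _≡_ f
  injective⇒surjective {f} f-injective y =
    let i , f′i≡y = finInjective⇒surjective f′-injective (enc y)
    in dec i , enc-injective f′i≡y
    where
    f′ : Fin size → Fin size
    f′ = enc ∘ f ∘ dec
    f′-injective : Injective _≡_ _≡_ f′
    f′-injective = dec-injective ∘ f-injective ∘ enc-injective

  -- c₀ ∷ c₁ ∷ … ∷ cₙ₋₁ encodes the monic polynomial c₀ + c₁ X + … + cₙ₋₁ X ^ (n ∸ 1) + X ^ n.
  evalMonic : List Carrier → Carrier → Carrier
  evalMonic []       x = 1#
  evalMonic (c ∷ cs) x = c + x * evalMonic cs x

  private
    quotient : List Carrier → Carrier → List Carrier
    quotient []       r = []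
    quotient (c ∷ cs) r = evalMonic (c ∷ cs) r ∷ quotient cs r

    length-quotient : ∀ cs r → length (quotient cs r) ≡ length cs
    length-quotient []       r = ≡.refl
    length-quotient (c ∷ cs) r = cong suc (length-quotient cs r)

    factor-theorem : ∀ c cs r x →
                     evalMonic (c ∷ cs) x ≡ evalMonic (c ∷ cs) r + (x - r) * evalMonic (quotient cs r) x
    factor-theorem c []       r x = solve 4 (λ c x r o → c :+ x :* o := (c :+ r :* o) :+ (x :- r) :* o) ≡.refl c x r 1#
    factor-theorem c (d ∷ ds) r x = begin
      c + x * evalMonic (d ∷ ds) x          ≡⟨ cong (λ y → c + x * y) (factor-theorem d ds r x) ⟩
      c + x * (P + (x - r) * Q)             ≡⟨ solve 5 (λ c x r P Q → c :+ x :* (P :+ (x :- r) :* Q)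
                                                         := (c :+ r :* P) :+ (x :- r) :* (P :+ x :* Q)) ≡.refl c x r P Q ⟩
      (c + r * P) + (x - r) * (P + x * Q)   ∎
      where
      P = evalMonic (d ∷ ds) r
      Q = evalMonic (quotient ds r) x

  roots≤degree : ∀ cs {m} (v : Fin m → Carrier) → Injective _≡_ _≡_ v →
                 (∀ i → evalMonic cs (v i) ≡ 0#) → m ℕ.≤ length cs
  roots≤degree cs       {zero}  v v-injective roots = ℕ.z≤n
  roots≤degree []       {suc m} v v-injective roots = contradiction (roots Fin.zero) 1≢0
  roots≤degree (c ∷ cs) {suc m} v v-injective roots =
    ℕ.s≤s (≡.subst (m ℕ.≤_) (length-quotient cs r)
      (roots≤degree (quotient cs r) (v ∘ Fin.suc) (Fin.suc-injective ∘ v-injective) quotient-roots))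
    where
    r = v Fin.zero
    quotient-roots : ∀ i → evalMonic (quotient cs r) (v (Fin.suc i)) ≡ 0#
    quotient-roots i = x≢0∧x*y≡0⇒y≡0 vᵢ-r≢0 (begin
      (vᵢ - r) * Q                          ≡⟨ +-identityˡ _ ⟨
      0# + (vᵢ - r) * Q                     ≡⟨ cong (_+ (vᵢ - r) * Q) (roots Fin.zero) ⟨
      evalMonic (c ∷ cs) r + (vᵢ - r) * Q   ≡⟨ factor-theorem c cs r vᵢ ⟨
      evalMonic (c ∷ cs) vᵢ                 ≡⟨ roots (Fin.suc i) ⟩
      0#                                    ∎)
      where
      vᵢ = v (Fin.suc i)
      Q = evalMonic (quotient cs r) vᵢ
      vᵢ-r≢0 : vᵢ - r ≢ 0#
      vᵢ-r≢0 vᵢ-r≡0 = contradiction (v-injective (x-y≡0⇒x≡y _ _ vᵢ-r≡0)) λ ()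

  ∃x^[2+n]≢x : ∀ n → 2 ℕ.+ n ℕ.< size → ∃[ x ] x ^ (2 ℕ.+ n) ≢ x
  ∃x^[2+n]≢x n 2+n<size =
    let i , decᵢ-moves = Fin.¬∀⟶∃¬ size _ (λ i → dec i ^ (2 ℕ.+ n) ≟ dec i) ¬all-fixed
    in dec i , decᵢ-moves
    where
    X^[2+n]-X = 0# ∷ - 1# ∷ replicate n 0#
    evalMonic-X^[2+n]-X : ∀ x → evalMonic X^[2+n]-X x ≡ x ^ (2 ℕ.+ n) - x
    evalMonic-X^[2+n]-X x = begin
      0# + x * (- 1# + x * evalMonic (replicate n 0#) x)   ≡⟨ cong (λ y → 0# + x * (- 1# + x * y)) (evalMonic-Xⁿ n) ⟩
      0# + x * (- 1# + x * x ^ n)                          ≡⟨ solve 3 (λ x xⁿ o → con (ℤ.+ 0) :+ x :* (:- o :+ x :* xⁿ)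
                                                                          := x :* (x :* xⁿ) :- x :* o) ≡.refl x (x ^ n) 1# ⟩
      x * (x * x ^ n) - x * 1#                             ≡⟨ cong (λ y → x * (x * x ^ n) - y) (*-identityʳ x) ⟩
      x ^ (2 ℕ.+ n) - x                                    ∎
      where
      evalMonic-Xⁿ : ∀ n → evalMonic (replicate n 0#) x ≡ x ^ n
      evalMonic-Xⁿ zero    = ≡.refl
      evalMonic-Xⁿ (suc n) = ≡.trans (+-identityˡ _) (cong (x *_) (evalMonic-Xⁿ n))
    ¬all-fixed : ¬ (∀ i → dec i ^ (2 ℕ.+ n) ≡ dec i)
    ¬all-fixed all-fixed = ℕ.<⇒≱ 2+n<size (≡.subst (size ℕ.≤_) (cong (2 ℕ.+_) (List.length-replicate n))
      (roots≤degree X^[2+n]-X dec dec-injective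
        (λ i → ≡.trans (evalMonic-X^[2+n]-X (dec i)) (x≡y⇒x-y≡0 (all-fixed i)))))

  private
    ×≡fromℕ* : ∀ n z → n Mult.× z ≡ fromℕ n * z
    ×≡fromℕ* n z = begin
      n Mult.× z          ≡⟨ cong (n Mult.×_) (*-identityˡ z) ⟨
      n Mult.× (1# * z)   ≡⟨ Mult.×-assoc-* n 1# z ⟨
      (n Mult.× 1#) * z   ≡⟨ cong (_* z) (fromℕ≡×1 n) ⟨
      fromℕ n * z         ∎

    freshman's-dream : ∀ {n} → 0 ℕ.< n → (∀ {k} → 0 ℕ.< k → k ℕ.< n → fromℕ (n C k) ≡ 0#) →
                       ∀ x y → (x + y) ^ n ≡ x ^ n + y ^ n
    freshman's-dream {suc m} _ middle≡0 x y = begin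
      (x + y) ^ n                                 ≡⟨ ^≡Exp^ (x + y) n ⟩
      (x + y) Exp.^ n                             ≡⟨ Binomial.theorem n x y ⟩
      term Fin.zero + ∑.sum (term ∘ Fin.suc)      ≡⟨ cong (term Fin.zero +_) (∑.sum-init-last (term ∘ Fin.suc)) ⟩
      term Fin.zero + (∑.sum middle + term top)   ≡⟨ cong (λ s → term Fin.zero + (s + term top)) ∑middle≡0 ⟩
      term Fin.zero + (0# + term top)             ≡⟨ cong₂ (λ a b → a + (0# + b)) first last ⟩
      y ^ n + (0# + x ^ n)                        ≡⟨ solve 2 (λ x y → y :+ (con (ℤ.+ 0) :+ x) := x :+ y) ≡.refl (x ^ n) (y ^ n) ⟩
      x ^ n + y ^ n                               ∎
      where
      n = suc m
      term = Binomial.binomialTerm x y n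
      top = Fin.fromℕ n
      middle = Vec.init (term ∘ Fin.suc)
      ∑middle≡0 : ∑.sum middle ≡ 0#
      ∑middle≡0 = ≡.trans (∑.sum-cong-≗ vanish) (∑.sum-replicate-zero m)
        where
        vanish : ∀ i → middle i ≡ 0#
        vanish i = begin
          (n C k) Mult.× b    ≡⟨ ×≡fromℕ* (n C k) b ⟩
          fromℕ (n C k) * b   ≡⟨ cong (_* b) (middle≡0 ℕ.z<s (ℕ.s≤s k∸1<m)) ⟩
          0# * b              ≡⟨ zeroˡ b ⟩
          0#                  ∎
          where
          k = suc (Fin.toℕ (Fin.inject₁ i))
          b = Binomial.binomial x y n (Fin.suc (Fin.inject₁ i))
          k∸1<m : Fin.toℕ (Fin.inject₁ i) ℕ.< m
          k∸1<m = ≡.subst (ℕ._< m) (≡.sym (Fin.toℕ-inject₁ i)) (Fin.toℕ<n i)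
      first : term Fin.zero ≡ y ^ n
      first = ≡.trans (+-identityʳ _) (≡.trans (*-identityˡ _) (≡.sym (^≡Exp^ y n)))
      last : term top ≡ x ^ n
      last = begin
        term top
          ≡⟨ cong (λ k → (n C k) Mult.× (x Exp.^ k * y Exp.^ (n ℕ.∸ k))) (Fin.toℕ-fromℕ n) ⟩
        (n C n) Mult.× (x Exp.^ n * y Exp.^ (n ℕ.∸ n))
          ≡⟨ cong₂ (λ c k → c Mult.× (x Exp.^ n * y Exp.^ k)) (nCn≡1 n) (ℕ.n∸n≡0 n) ⟩
        1 Mult.× (x Exp.^ n * 1#)   ≡⟨ +-identityʳ _ ⟩
        x Exp.^ n * 1#              ≡⟨ *-identityʳ _ ⟩
        x Exp.^ n                   ≡⟨ ^≡Exp^ x n ⟨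
        x ^ n                       ∎

  module _ {p} (p-prime : Prime p) (fromℕ-p≡0 : fromℕ p ≡ 0#) where

    ^p-+ : ∀ x y → (x + y) ^ p ≡ x ^ p + y ^ p
    ^p-+ = freshman's-dream (ℕ.<-trans ℕ.z<s (1<p p-prime)) fromℕ-pCk≡0
      where
      fromℕ-pCk≡0 : ∀ {k} → 0 ℕ.< k → k ℕ.< p → fromℕ (p C k) ≡ 0#
      fromℕ-pCk≡0 {k} 0<k k<p with p∣pCk p-prime 0<k k<p
      ... | divides c pCk≡c*p = begin
        fromℕ (p C k)       ≡⟨ cong fromℕ pCk≡c*p ⟩
        fromℕ (c ℕ.* p)     ≡⟨ fromℕ-* c p ⟩
        fromℕ c * fromℕ p   ≡⟨ cong (fromℕ c *_) fromℕ-p≡0 ⟩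
        fromℕ c * 0#        ≡⟨ zeroʳ _ ⟩
        0#                  ∎

    ^pⁿ-+ : ∀ n x y → (x + y) ^ (p ℕ.^ n) ≡ x ^ (p ℕ.^ n) + y ^ (p ℕ.^ n)
    ^pⁿ-+ zero    x y = distribʳ 1# x y
    ^pⁿ-+ (suc n) x y = begin
      (x + y) ^ (p ℕ.* p ℕ.^ n)                   ≡⟨ ^-* (x + y) p (p ℕ.^ n) ⟩
      ((x + y) ^ p) ^ (p ℕ.^ n)                   ≡⟨ cong (_^ (p ℕ.^ n)) (^p-+ x y) ⟩
      (x ^ p + y ^ p) ^ (p ℕ.^ n)                 ≡⟨ ^pⁿ-+ n (x ^ p) (y ^ p) ⟩
      (x ^ p) ^ (p ℕ.^ n) + (y ^ p) ^ (p ℕ.^ n)   ≡⟨ cong₂ _+_ (^-* x p (p ℕ.^ n)) (^-* y p (p ℕ.^ n)) ⟨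
      x ^ (p ℕ.* p ℕ.^ n) + y ^ (p ℕ.* p ℕ.^ n)   ∎

module _ (L : FiniteField) where

  open FieldProperties L
  open ≡.≡-Reasoning

  module CubicAutomorphism
    (σ : Carrier → Carrier) (σ-+ : Additive σ) (σ-* : ∀ x y → σ (x * y) ≡ σ x * σ y)
    (σ³ : ∀ x → σ (σ (σ x)) ≡ x)
    where

    open import Data.Product using (_×_)

    σ-injective : Injective _≡_ _≡_ σ
    σ-injective {x} {y} σx≡σy = ≡.trans (≡.sym (σ³ x)) (≡.trans (cong (σ ∘ σ) σx≡σy) (σ³ y))

    σ-0 : σ 0# ≡ 0#
    σ-0 = +-cancelˡ (σ 0#) _ _ (begin
      σ 0# + σ 0#   ≡⟨ σ-+ 0# 0# ⟨
      σ (0# + 0#)   ≡⟨ cong σ (+-identityʳ 0#) ⟩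
      σ 0#          ≡⟨ +-identityʳ (σ 0#) ⟨
      σ 0# + 0#     ∎)

    σ-≢0 : ∀ {x} → x ≢ 0# → σ x ≢ 0#
    σ-≢0 x≢0 σx≡0 = x≢0 (σ-injective (≡.trans σx≡0 (≡.sym σ-0)))

    σ-1 : σ 1# ≡ 1#
    σ-1 = *-cancelˡ (σ-≢0 1≢0) (begin
      σ 1# * σ 1#   ≡⟨ σ-* 1# 1# ⟨
      σ (1# * 1#)   ≡⟨ cong σ (*-identityʳ 1#) ⟩
      σ 1#          ≡⟨ *-identityʳ (σ 1#) ⟨
      σ 1# * 1#     ∎)

    σ-neg : ∀ x → σ (- x) ≡ - σ x
    σ-neg x = +-cancelˡ (σ x) _ _ (begin
      σ x + σ (- x)   ≡⟨ σ-+ x (- x) ⟨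
      σ (x - x)       ≡⟨ cong σ (-‿inverseʳ x) ⟩
      σ 0#            ≡⟨ σ-0 ⟩
      0#              ≡⟨ -‿inverseʳ (σ x) ⟨
      σ x - σ x       ∎)

    σ-sub : ∀ x y → σ (x - y) ≡ σ x - σ y
    σ-sub x y = ≡.trans (σ-+ x (- y)) (cong (σ x +_) (σ-neg y))

    Fixed : Carrier → Set
    Fixed c = σ c ≡ c

    fixed-fromℕ : ∀ n → Fixed (fromℕ n)
    fixed-fromℕ zero    = σ-0
    fixed-fromℕ (suc n) = ≡.trans (σ-+ 1# (fromℕ n)) (cong₂ _+_ σ-1 (fixed-fromℕ n))

    fixed-neg : ∀ {a} → Fixed a → Fixed (- a)
    fixed-neg {a} σa≡a = ≡.trans (σ-neg a) (cong -_ σa≡a)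

    fixed-sub : ∀ {a b} → Fixed a → Fixed b → Fixed (a - b)
    fixed-sub {a} {b} σa≡a σb≡b = ≡.trans (σ-sub a b) (cong₂ _-_ σa≡a σb≡b)

    fixed-* : ∀ {a b} → Fixed a → Fixed b → Fixed (a * b)
    fixed-* {a} {b} σa≡a σb≡b = ≡.trans (σ-* a b) (cong₂ _*_ σa≡a σb≡b)

    fixed-inverse : ∀ {a a⁻¹} → a ≢ 0# → a * a⁻¹ ≡ 1# → Fixed a → Fixed a⁻¹
    fixed-inverse {a} {a⁻¹} a≢0 aa⁻¹≡1 σa≡a = *-cancelˡ a≢0 (begin
      a * σ a⁻¹     ≡⟨ cong (_* σ a⁻¹) σa≡a ⟨
      σ a * σ a⁻¹   ≡⟨ σ-* a a⁻¹ ⟨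
      σ (a * a⁻¹)   ≡⟨ cong σ aa⁻¹≡1 ⟩
      σ 1#          ≡⟨ σ-1 ⟩
      1#            ≡⟨ aa⁻¹≡1 ⟨
      a * a⁻¹       ∎)

    σ-scale : ∀ {c} → Fixed c → ∀ x → σ (c * x) ≡ c * σ x
    σ-scale {c} σc≡c x = ≡.trans (σ-* c x) (cong (_* σ x) σc≡c)

    σ²-+ : Additive (σ ∘ σ)
    σ²-+ x y = ≡.trans (cong σ (σ-+ x y)) (σ-+ (σ x) (σ y))

    σ²-scale : ∀ {c} → Fixed c → ∀ x → σ (σ (c * x)) ≡ c * σ (σ x)
    σ²-scale σc≡c x = ≡.trans (cong σ (σ-scale σc≡c x)) (σ-scale σc≡c (σ x))

    σ-eigen : ∀ {a b t} → Fixed a → Fixed b → a * σ t ≡ b * t → a * σ (σ t) ≡ b * σ t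
    σ-eigen {a} {b} {t} σa≡a σb≡b a*σt≡b*t = begin
      a * σ (σ t)   ≡⟨ σ-scale σa≡a (σ t) ⟨
      σ (a * σ t)   ≡⟨ cong σ a*σt≡b*t ⟩
      σ (b * t)     ≡⟨ σ-scale σb≡b t ⟩
      b * σ t       ∎

    -- Multiplying the three conjugates of a σt ≡ b t gives a³ N ≡ b³ N for the norm N = t σt σ²t ≢ 0.
    eigen⇒cube≡ : ∀ {a b t} → Fixed a → Fixed b → t ≢ 0# → a * σ t ≡ b * t → a ^ 3 ≡ b ^ 3
    eigen⇒cube≡ {a} {b} {t} σa≡a σb≡b t≢0 e₀ = *-cancelˡ (*-≢0 (*-≢0 t≢0 (σ-≢0 t≢0)) (σ-≢0 (σ-≢0 t≢0))) (begin
      t * t₁ * t₂ * a ^ 3             ≡⟨ solve 4 (λ a t t₁ t₂ → t :* t₁ :* t₂ :* a :^ 3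
                                                   := (a :* t₁) :* (a :* t₂) :* (a :* t)) ≡.refl a t t₁ t₂ ⟩
      (a * t₁) * (a * t₂) * (a * t)   ≡⟨ cong₂ _*_ (cong₂ _*_ e₀ e₁) e₂ ⟩
      (b * t) * (b * t₁) * (b * t₂)   ≡⟨ solve 4 (λ b t t₁ t₂ → (b :* t) :* (b :* t₁) :* (b :* t₂)
                                                   := t :* t₁ :* t₂ :* b :^ 3) ≡.refl b t t₁ t₂ ⟩
      t * t₁ * t₂ * b ^ 3             ∎)
      where
      t₁ = σ t
      t₂ = σ (σ t)
      e₁ : a * t₂ ≡ b * t₁
      e₁ = σ-eigen σa≡a σb≡b e₀
      e₂ : a * t ≡ b * t₂
      e₂ = ≡.trans (≡.sym (cong (a *_) (σ³ t))) (σ-eigen σa≡a σb≡b e₁)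

    twisted : Carrier → Carrier → Carrier
    twisted r z = z + r * r * σ z + r * σ (σ z)

    σ-twisted : ∀ {r} → Fixed r → r ^ 3 ≡ 1# → ∀ z → σ (twisted r z) ≡ r * twisted r z
    σ-twisted {r} σr≡r r³≡1 z = begin
      σ (twisted r z)                          ≡⟨ σ-+ _ _ ⟩
      σ (z + r * r * σ z) + σ (r * σ (σ z))    ≡⟨ cong₂ _+_ σ[z+r²σz] σ[rσ²z] ⟩
      σ z + r * r * σ (σ z) + r * z            ≡⟨ cong (λ u → u + r * r * σ (σ z) + r * z) (*-identityˡ (σ z)) ⟨
      1# * σ z + r * r * σ (σ z) + r * z       ≡⟨ cong (λ c → c * σ z + r * r * σ (σ z) + r * z) r³≡1 ⟨
      r ^ 3 * σ z + r * r * σ (σ z) + r * z    ≡⟨ solve 4 (λ r z s t → r :^ 3 :* s :+ r :* r :* t :+ r :* z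
                                                            := r :* (z :+ r :* r :* s :+ r :* t)) ≡.refl r z (σ z) (σ (σ z)) ⟩
      r * twisted r z                          ∎
      where
      σ[z+r²σz] : σ (z + r * r * σ z) ≡ σ z + r * r * σ (σ z)
      σ[z+r²σz] = ≡.trans (σ-+ _ _) (cong (σ z +_) (σ-scale (fixed-* σr≡r σr≡r) (σ z)))
      σ[rσ²z] : σ (r * σ (σ z)) ≡ r * z
      σ[rσ²z] = ≡.trans (σ-scale σr≡r (σ (σ z))) (cong (r *_) (σ³ z))

    -- Eliminating w between twisted r w ≡ 0 and twisted r (w * w) ≡ 0 leaves (σ²w − σw)² ≡ 0.
    twisted-vanishes⇒fixed : ∀ {r w} → 1# + r + r * r ≡ 0# → twisted r w ≡ 0# → twisted r (w * w) ≡ 0# → σ w ≡ w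
    twisted-vanishes⇒fixed {r} {w} N≡0 A₁≡0 A₂≡0 = σ-injective (x-y≡0⇒x≡y s₂ s₁ (x*x≡0⇒x≡0 (begin
      (s₂ - s₁) * (s₂ - s₁)                     ≡⟨ elimination ⟩
      Q * A₁ + K * (fromℕ 1 + r + r * r) - A₂   ≡⟨ cong₂ (λ u v → Q * u + K * v - A₂) A₁≡0 N≡0′ ⟩
      Q * 0# + K * 0# - A₂                      ≡⟨ cong (λ u → Q * 0# + K * 0# - u) A₂≡0′ ⟩
      Q * 0# + K * 0# - 0#                      ≡⟨ solve 2 (λ q k → q :* con (ℤ.+ 0) :+ k :* con (ℤ.+ 0) :- con (ℤ.+ 0)
                                                              := con (ℤ.+ 0)) ≡.refl Q K ⟩
      0#                                        ∎)))
      where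
      s₁ = σ w
      s₂ = σ (σ w)
      A₁ = w + r * r * s₁ + r * s₂
      A₂ = w * w + r * r * (s₁ * s₁) + r * (s₂ * s₂)
      Q = w - r * r * s₁ - r * s₂
      K = s₁ * s₁ * (fromℕ 1 - r + r * r) + s₂ * s₂ + fromℕ 2 * (r - fromℕ 1) * s₁ * s₂
      N≡0′ : fromℕ 1 + r + r * r ≡ 0#
      N≡0′ = ≡.trans (cong (λ o → o + r + r * r) (+-identityʳ 1#)) N≡0
      A₂≡0′ : A₂ ≡ 0#
      A₂≡0′ = ≡.trans (cong₂ (λ u v → w * w + r * r * u + r * v) (≡.sym (σ-* w w))
                        (≡.sym (≡.trans (cong σ (σ-* w w)) (σ-* s₁ s₁)))) A₂≡0
      elimination : (s₂ - s₁) * (s₂ - s₁) ≡ Q * A₁ + K * (fromℕ 1 + r + r * r) - A₂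
      elimination = solve 4 (λ r w s₁ s₂ →
        (s₂ :- s₁) :* (s₂ :- s₁) :=
          (w :- r :* r :* s₁ :- r :* s₂) :* (w :+ r :* r :* s₁ :+ r :* s₂)
          :+ (s₁ :* s₁ :* (con (ℤ.+ 1) :- r :+ r :* r) :+ s₂ :* s₂ :+ con (ℤ.+ 2) :* (r :- con (ℤ.+ 1)) :* s₁ :* s₂)
             :* (con (ℤ.+ 1) :+ r :+ r :* r)
          :- (w :* w :+ r :* r :* (s₁ :* s₁) :+ r :* (s₂ :* s₂))) ≡.refl r w s₁ s₂

    module _ {w} (σw≢w : σ w ≢ w) where

      eigen-of-cube-root : ∀ {r} → Fixed r → r ^ 3 ≡ 1# → ∃[ t ] (t ≢ 0# × σ t ≡ r * t)
      eigen-of-cube-root {r} σr≡r r³≡1 with r ≟ 1#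
      ... | yes ≡.refl = 1# , 1≢0 , ≡.trans σ-1 (≡.sym (*-identityʳ 1#))
      ... | no r≢1 with twisted r w ≟ 0# | twisted r (w * w) ≟ 0#
      ...   | no A₁≢0  | _        = twisted r w , A₁≢0 , σ-twisted σr≡r r³≡1 w
      ...   | yes _    | no A₂≢0  = twisted r (w * w) , A₂≢0 , σ-twisted σr≡r r³≡1 (w * w)
      ...   | yes A₁≡0 | yes A₂≡0 = contradiction (twisted-vanishes⇒fixed N≡0 A₁≡0 A₂≡0) σw≢w
        where
        r-1≢0 : r - 1# ≢ 0#
        r-1≢0 r-1≡0 = r≢1 (x-y≡0⇒x≡y r 1# r-1≡0)
        N≡0 : 1# + r + r * r ≡ 0#
        N≡0 = x≢0∧x*y≡0⇒y≡0 r-1≢0 (begin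
          (r - 1#) * (1# + r + r * r)             ≡⟨ cong (λ o → (r - o) * (o + r + r * r)) (+-identityʳ 1#) ⟨
          (r - fromℕ 1) * (fromℕ 1 + r + r * r)   ≡⟨ solve 1 (λ r → (r :- con (ℤ.+ 1)) :* (con (ℤ.+ 1) :+ r :+ r :* r)
                                                                 := r :^ 3 :- con (ℤ.+ 1)) ≡.refl r ⟩
          r ^ 3 - fromℕ 1                         ≡⟨ cong (λ o → r ^ 3 - o) (+-identityʳ 1#) ⟩
          r ^ 3 - 1#                              ≡⟨ x≡y⇒x-y≡0 r³≡1 ⟩
          0#                                      ∎)

      cube≡⇒eigen : ∀ {a b} → Fixed a → Fixed b → a ^ 3 ≡ b ^ 3 → ∃[ t ] (t ≢ 0# × a * σ t ≡ b * t)
      cube≡⇒eigen {a} {b} σa≡a σb≡b a³≡b³ with a ≟ 0#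
      ... | yes ≡.refl = 1# , 1≢0 , ≡.trans (zeroˡ (σ 1#)) (≡.sym (≡.trans (cong (_* 1#) b≡0) (zeroˡ 1#)))
        where
        b≡0 : b ≡ 0#
        b≡0 = x^n≡0⇒x≡0 3 (≡.trans (≡.sym a³≡b³) (zeroˡ _))
      ... | no a≢0 =
        let t , t≢0 , σt≡rt = eigen-of-cube-root (fixed-* σb≡b (fixed-inverse a≢0 aa⁻¹≡1 σa≡a)) r³≡1
        in t , t≢0 , (begin
          a * σ t               ≡⟨ cong (a *_) σt≡rt ⟩
          a * (b * a⁻¹ * t)     ≡⟨ solve 4 (λ a b i t → a :* (b :* i :* t) := (a :* i) :* (b :* t)) ≡.refl a b a⁻¹ t ⟩
          (a * a⁻¹) * (b * t)   ≡⟨ cong (_* (b * t)) aa⁻¹≡1 ⟩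
          1# * (b * t)          ≡⟨ *-identityˡ _ ⟩
          b * t                 ∎)
        where
        a⁻¹ = proj₁ (inverse a a≢0)
        aa⁻¹≡1 : a * a⁻¹ ≡ 1#
        aa⁻¹≡1 = proj₂ (inverse a a≢0)
        r³≡1 : (b * a⁻¹) ^ 3 ≡ 1#
        r³≡1 = begin
          (b * a⁻¹) ^ 3     ≡⟨ *-^ b a⁻¹ 3 ⟩
          b ^ 3 * a⁻¹ ^ 3   ≡⟨ cong (_* a⁻¹ ^ 3) a³≡b³ ⟨
          a ^ 3 * a⁻¹ ^ 3   ≡⟨ *-^ a a⁻¹ 3 ⟨
          (a * a⁻¹) ^ 3     ≡⟨ cong (_^ 3) aa⁻¹≡1 ⟩
          1# * (1# * (1# * 1#))   ≡⟨ ≡.trans (*-identityˡ _) (≡.trans (*-identityˡ _) (*-identityˡ 1#)) ⟩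
          1#                ∎

    T : Carrier → Carrier
    T x = x + σ x

    T-+ : Additive T
    T-+ x y = ≡.trans (cong ((x + y) +_) (σ-+ x y))
                      (solve 4 (λ x y u v → x :+ y :+ (u :+ v) := x :+ u :+ (y :+ v)) ≡.refl x y (σ x) (σ y))

    T-0 : T 0# ≡ 0#
    T-0 = ≡.trans (cong (0# +_) σ-0) (+-identityʳ 0#)

    σ²-T : ∀ x → σ (σ (T x)) ≡ x + σ (σ x)
    σ²-T x = begin
      σ (σ (x + σ x))         ≡⟨ σ²-+ x (σ x) ⟩
      σ (σ x) + σ (σ (σ x))   ≡⟨ cong (σ (σ x) +_) (σ³ x) ⟩
      σ (σ x) + x             ≡⟨ +-comm _ x ⟩
      x + σ (σ x)             ∎

    T-preimage : ∀ x → T (x - σ x + σ (σ x)) ≡ fromℕ 2 * x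
    T-preimage x = begin
      T (x - σ x + σ (σ x))                       ≡⟨ cong ((x - σ x + σ (σ x)) +_) σ-preimage ⟩
      (x - σ x + σ (σ x)) + (σ x - σ (σ x) + x)   ≡⟨ solve 3 (λ x s t → (x :- s :+ t) :+ (s :- t :+ x) := con (ℤ.+ 2) :* x)
                                                                 ≡.refl x (σ x) (σ (σ x)) ⟩
      fromℕ 2 * x                                 ∎
      where
      σ-preimage : σ (x - σ x + σ (σ x)) ≡ σ x - σ (σ x) + x
      σ-preimage = ≡.trans (σ-+ _ _) (cong₂ _+_ (σ-sub x (σ x)) (σ³ x))

    -- T x ≡ 0 means σ x ≡ − x, so σ² fixes x, hence so does σ (as σ³ fixes x), and 2 x ≡ T x ≡ 0.
    T-trivialKernel : fromℕ 2 ≢ 0# → TrivialKernel T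
    T-trivialKernel 2≢0 x Tx≡0 = x≢0∧x*y≡0⇒y≡0 2≢0 (begin
      fromℕ 2 * x   ≡⟨ solve 1 (λ x → con (ℤ.+ 2) :* x := x :+ x) ≡.refl x ⟩
      x + x         ≡⟨ cong (x +_) σx≡x ⟨
      x + σ x       ≡⟨ Tx≡0 ⟩
      0#            ∎)
      where
      σx≡-x : σ x ≡ - x
      σx≡-x = +-cancelˡ x _ _ (≡.trans Tx≡0 (≡.sym (-‿inverseʳ x)))
      σ²x≡x : σ (σ x) ≡ x
      σ²x≡x = ≡.trans (cong σ σx≡-x) (≡.trans (σ-neg x) (≡.trans (cong -_ σx≡-x) (-‿involutive x)))
      σx≡x : σ x ≡ x
      σx≡x = ≡.trans (cong σ (≡.sym σ²x≡x)) (σ³ x)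

    module Linearized {α β} (σα≡α : Fixed α) (σβ≡β : Fixed β) where

      Λ : Carrier → Carrier
      Λ t = α * t + β * σ (σ t)

      Λ-+ : Additive Λ
      Λ-+ s t = begin
        α * (s + t) + β * σ (σ (s + t))         ≡⟨ cong (λ u → α * (s + t) + β * u) (σ²-+ s t) ⟩
        α * (s + t) + β * (σ (σ s) + σ (σ t))   ≡⟨ solve 6 (λ α β s t u v → α :* (s :+ t) :+ β :* (u :+ v)
                                                              := (α :* s :+ β :* u) :+ (α :* t :+ β :* v))
                                                              ≡.refl α β s t (σ (σ s)) (σ (σ t)) ⟩
        Λ s + Λ t                               ∎

      Λ-scale : ∀ {c} → Fixed c → ∀ t → Λ (c * t) ≡ c * Λ t
      Λ-scale {c} σc≡c t = begin
        α * (c * t) + β * σ (σ (c * t))   ≡⟨ cong (λ u → α * (c * t) + β * u) (σ²-scale σc≡c t) ⟩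
        α * (c * t) + β * (c * σ (σ t))   ≡⟨ solve 5 (λ α β c t u → α :* (c :* t) :+ β :* (c :* u) := c :* (α :* t :+ β :* u))
                                                       ≡.refl α β c t (σ (σ t)) ⟩
        c * Λ t                           ∎

      Λ-0 : Λ 0# ≡ 0#
      Λ-0 = ≡.trans (cong Λ (≡.sym (zeroˡ 0#))) (≡.trans (Λ-scale σ-0 0#) (zeroˡ _))

      Λ≡0⇒eigen : ∀ {t} → Λ t ≡ 0# → (- α) * σ t ≡ β * t
      Λ≡0⇒eigen {t} Λt≡0 = begin
        (- α) * σ t                 ≡⟨ solve 4 (λ α β s t → (:- α) :* s := β :* t :- (α :* s :+ β :* t)) ≡.refl α β (σ t) t ⟩
        β * t - (α * σ t + β * t)   ≡⟨ cong (λ u → β * t - u) σΛt≡0 ⟩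
        β * t - 0#                  ≡⟨ solve 1 (λ u → u :- con (ℤ.+ 0) := u) ≡.refl (β * t) ⟩
        β * t                       ∎
        where
        σΛt≡0 : α * σ t + β * t ≡ 0#
        σΛt≡0 = begin
          α * σ t + β * t               ≡⟨ cong (λ u → α * σ t + β * u) (σ³ t) ⟨
          α * σ t + β * σ (σ (σ t))     ≡⟨ cong₂ _+_ (σ-scale σα≡α t) (σ-scale σβ≡β (σ (σ t))) ⟨
          σ (α * t) + σ (β * σ (σ t))   ≡⟨ σ-+ _ _ ⟨
          σ (Λ t)                       ≡⟨ cong σ Λt≡0 ⟩
          σ 0#                          ≡⟨ σ-0 ⟩
          0#                            ∎

      eigen⇒Λ≡0 : ∀ {t} → (- α) * σ t ≡ β * t → Λ t ≡ 0#
      eigen⇒Λ≡0 {t} e₀ = begin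
        α * t + β * σ (σ t)   ≡⟨ cong (α * t +_) e₂ ⟨
        α * t + (- α) * t     ≡⟨ solve 2 (λ α t → α :* t :+ (:- α) :* t := con (ℤ.+ 0)) ≡.refl α t ⟩
        0#                    ∎
        where
        e₂ : (- α) * t ≡ β * σ (σ t)
        e₂ = ≡.trans (cong ((- α) *_) (≡.sym (σ³ t)))
               (σ-eigen (fixed-neg σα≡α) σβ≡β (σ-eigen (fixed-neg σα≡α) σβ≡β e₀))

      Λ-trivialKernel⇔ : ∀ {w} → σ w ≢ w → TrivialKernel Λ ⇔ α ^ 3 + β ^ 3 ≢ 0#
      Λ-trivialKernel⇔ σw≢w = mk⇔
        (λ kernel α³+β³≡0 →
          let t , t≢0 , eigen = cube≡⇒eigen σw≢w (fixed-neg σα≡α) σβ≡β (Equivalence.from cube-identity α³+β³≡0)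
          in t≢0 (kernel t (eigen⇒Λ≡0 eigen)))
        (λ α³+β³≢0 t Λt≡0 → decidable-stable (t ≟ 0#) (λ t≢0 →
          α³+β³≢0 (Equivalence.to cube-identity (eigen⇒cube≡ (fixed-neg σα≡α) σβ≡β t≢0 (Λ≡0⇒eigen Λt≡0)))))
        where
        cube-identity : (- α) ^ 3 ≡ β ^ 3 ⇔ α ^ 3 + β ^ 3 ≡ 0#
        cube-identity = [-a]³≡b³⇔a³+b³≡0 α β

      module _ (2≢0 : fromℕ 2 ≢ 0#) {f : Carrier → Carrier} (f≡Λ[T²] : ∀ x → f x ≡ Λ (T x * T x)) where

        Δ-f : ∀ x e → f (x + e) - f x ≡ fromℕ 2 * Λ (T x * T e) + f e
        Δ-f x e = begin
          f (x + e) - f x                                               ≡⟨ cong₂ _-_ (f≡Λ[T²] (x + e)) (f≡Λ[T²] x) ⟩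
          Λ (T (x + e) * T (x + e)) - Λ (u * u)                         ≡⟨ cong (λ s → Λ (s * s) - Λ (u * u)) (T-+ x e) ⟩
          Λ ((u + v) * (u + v)) - Λ (u * u)                             ≡⟨ cong (λ s → Λ s - Λ (u * u)) [u+v]²≡u²+[2uv+v²] ⟩
          Λ (u * u + (fromℕ 2 * (u * v) + v * v)) - Λ (u * u)           ≡⟨ cong (_- Λ (u * u)) Λ[u²+[2uv+v²]] ⟩
          Λ (u * u) + (Λ (fromℕ 2 * (u * v)) + Λ (v * v)) - Λ (u * u)   ≡⟨ cong (λ s → Λ (u * u) + (s + Λ (v * v)) - Λ (u * u))
                                                                                 (Λ-scale (fixed-fromℕ 2) (u * v)) ⟩
          Λ (u * u) + (fromℕ 2 * Λ (u * v) + Λ (v * v)) - Λ (u * u)     ≡⟨ solve 2 (λ a b → a :+ b :- a := b) ≡.refl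
                                                                                 (Λ (u * u)) (fromℕ 2 * Λ (u * v) + Λ (v * v)) ⟩
          fromℕ 2 * Λ (u * v) + Λ (v * v)                               ≡⟨ cong (fromℕ 2 * Λ (u * v) +_) (f≡Λ[T²] e) ⟨
          fromℕ 2 * Λ (u * v) + f e                                     ∎
          where
          u = T x
          v = T e
          [u+v]²≡u²+[2uv+v²] : (u + v) * (u + v) ≡ u * u + (fromℕ 2 * (u * v) + v * v)
          [u+v]²≡u²+[2uv+v²] = solve 2 (λ u v → (u :+ v) :* (u :+ v) := u :* u :+ (con (ℤ.+ 2) :* (u :* v) :+ v :* v)) ≡.refl u v
          Λ[u²+[2uv+v²]] : Λ (u * u + (fromℕ 2 * (u * v) + v * v)) ≡ Λ (u * u) + (Λ (fromℕ 2 * (u * v)) + Λ (v * v))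
          Λ[u²+[2uv+v²]] = ≡.trans (Λ-+ _ _) (cong (Λ (u * u) +_) (Λ-+ _ _))

        Λ[TxTe]≡0⇒Δ≡Δ0 : ∀ {x e} → Λ (T x * T e) ≡ 0# → f (x + e) - f x ≡ f (0# + e) - f 0#
        Λ[TxTe]≡0⇒Δ≡Δ0 {x} {e} Λ[TxTe]≡0 = begin
          f (x + e) - f x                  ≡⟨ Δ-f x e ⟩
          fromℕ 2 * Λ (T x * T e) + f e    ≡⟨ cong (λ s → fromℕ 2 * s + f e) (≡.trans Λ[TxTe]≡0 (≡.sym Λ[T0Te]≡0)) ⟩
          fromℕ 2 * Λ (T 0# * T e) + f e   ≡⟨ Δ-f 0# e ⟨
          f (0# + e) - f 0#                ∎
          where
          Λ[T0Te]≡0 : Λ (T 0# * T e) ≡ 0#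
          Λ[T0Te]≡0 = ≡.trans (cong (λ s → Λ (s * T e)) T-0) (≡.trans (cong Λ (zeroˡ (T e))) Λ-0)

        -- For t in the kernel, x = t − σt + σ²t has T x ≡ 2 t, so x and 0 collide under X ↦ f (X + 1) − f X.
        planar⇒Λ-trivialKernel : Planar f → TrivialKernel Λ
        planar⇒Λ-trivialKernel planar t Λt≡0 = x≢0∧x*y≡0⇒y≡0 2≢0 2t≡0
          where
          x = t - σ t + σ (σ t)
          T1≡2 : T 1# ≡ fromℕ 2
          T1≡2 = ≡.trans (cong (1# +_) σ-1) (cong (1# +_) (≡.sym (+-identityʳ 1#)))
          Λ[TxT1]≡0 : Λ (T x * T 1#) ≡ 0#
          Λ[TxT1]≡0 = begin
            Λ (T x * T 1#)              ≡⟨ cong₂ (λ a b → Λ (a * b)) (T-preimage t) T1≡2 ⟩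
            Λ (fromℕ 2 * t * fromℕ 2)   ≡⟨ cong Λ (solve 1 (λ t → con (ℤ.+ 2) :* t :* con (ℤ.+ 2) := con (ℤ.+ 4) :* t)
                                                        ≡.refl t) ⟩
            Λ (fromℕ 4 * t)             ≡⟨ Λ-scale (fixed-fromℕ 4) t ⟩
            fromℕ 4 * Λ t               ≡⟨ cong (fromℕ 4 *_) Λt≡0 ⟩
            fromℕ 4 * 0#                ≡⟨ zeroʳ _ ⟩
            0#                          ∎
          x≡0 : x ≡ 0#
          x≡0 = proj₁ (planar 1# 1≢0) {x} {0#} (Λ[TxTe]≡0⇒Δ≡Δ0 {x} {1#} Λ[TxT1]≡0)
          2t≡0 : fromℕ 2 * t ≡ 0#
          2t≡0 = ≡.trans (≡.sym (T-preimage t)) (≡.trans (cong T x≡0) T-0)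

        Λ-trivialKernel⇒planar : TrivialKernel Λ → Planar f
        Λ-trivialKernel⇒planar kernel ε ε≢0 =
          Δ-injective , strictlySurjective⇒surjective (injective⇒surjective Δ-injective)
          where
          T-injective : Injective _≡_ _≡_ T
          T-injective = additive∧trivialKernel⇒injective T-+ (T-trivialKernel 2≢0)
          Λ-injective : Injective _≡_ _≡_ Λ
          Λ-injective = additive∧trivialKernel⇒injective Λ-+ kernel
          Δ-injective : Injective _≡_ _≡_ (λ x → f (x + ε) - f x)
          Δ-injective {a} {b} Δa≡Δb =
            T-injective {a} {b} (*-cancelʳ {T a} {T b} {T ε} (ε≢0 ∘ T-trivialKernel 2≢0 ε)
              (Λ-injective {T a * T ε} {T b * T ε} (*-cancelˡ 2≢0 (+-cancelʳ (f ε) _ _ 2Λ[TaTε]+fε≡2Λ[TbTε]+fε))))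
            where
            2Λ[TaTε]+fε≡2Λ[TbTε]+fε : fromℕ 2 * Λ (T a * T ε) + f ε ≡ fromℕ 2 * Λ (T b * T ε) + f ε
            2Λ[TaTε]+fε≡2Λ[TbTε]+fε = ≡.trans (≡.sym (Δ-f a ε)) (≡.trans Δa≡Δb (Δ-f b ε))

        planar⇔Λ-trivialKernel : Planar f ⇔ TrivialKernel Λ
        planar⇔Λ-trivialKernel = mk⇔ planar⇒Λ-trivialKernel Λ-trivialKernel⇒planar

  module Frobenius {q p k} (p-prime : Prime p) (q≡p^[1+k] : q ≡ p ℕ.^ suc k) (size≡q³ : size ≡ q ℕ.^ 3) where

    fromℕ-q≡0 : fromℕ q ≡ 0#
    fromℕ-q≡0 = x^n≡0⇒x≡0 3 (≡.trans (≡.sym (fromℕ-^ q 3)) (≡.trans (cong fromℕ (≡.sym size≡q³)) fromℕ-size≡0))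

    fromℕ-p≡0 : fromℕ p ≡ 0#
    fromℕ-p≡0 = x^n≡0⇒x≡0 (suc k)
      (≡.trans (≡.sym (fromℕ-^ p (suc k))) (≡.trans (cong fromℕ (≡.sym q≡p^[1+k])) fromℕ-q≡0))

    σ : Carrier → Carrier
    σ x = x ^ q

    σ-+ : Additive σ
    σ-+ x y = ≡.subst (λ n → (x + y) ^ n ≡ x ^ n + y ^ n) (≡.sym q≡p^[1+k]) (^pⁿ-+ p-prime fromℕ-p≡0 (suc k) x y)

    σ-* : ∀ x y → σ (x * y) ≡ σ x * σ y
    σ-* x y = *-^ x y q

    σ³ : ∀ x → σ (σ (σ x)) ≡ x
    σ³ x = begin
      ((x ^ q) ^ q) ^ q     ≡⟨ cong (_^ q) (^-* x q q) ⟨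
      (x ^ (q ℕ.* q)) ^ q   ≡⟨ ^-* x (q ℕ.* q) q ⟨
      x ^ (q ℕ.* q ℕ.* q)   ≡⟨ cong (x ^_) q*q*q≡size ⟩
      x ^ size              ≡⟨ ^-size x ⟩
      x                     ∎
      where
      q*q*q≡size : q ℕ.* q ℕ.* q ≡ size
      q*q*q≡size = ≡.trans (ℕ.*-assoc q q q)
        (≡.trans (cong (λ m → q ℕ.* (q ℕ.* m)) (≡.sym (ℕ.*-identityʳ q))) (≡.sym size≡q³))

    ∃σw≢w : ∃[ w ] σ w ≢ w
    ∃σw≢w = ≡.subst (λ m → ∃[ w ] w ^ m ≢ w) 2+n≡q (∃x^[2+n]≢x n (≡.subst (ℕ._< size) (≡.sym 2+n≡q) q<size))
      where
      1<q : 1 ℕ.< q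
      1<q = ≡.subst (1 ℕ.<_) (≡.sym q≡p^[1+k]) (ℕ.^-monoʳ-< p (1<p p-prime) {0} {suc k} ℕ.z<s)
      n = proj₁ (ℕ.m≤n⇒∃[o]m+o≡n 1<q)
      2+n≡q : 2 ℕ.+ n ≡ q
      2+n≡q = proj₂ (ℕ.m≤n⇒∃[o]m+o≡n 1<q)
      q<size : q ℕ.< size
      q<size = ≡.subst₂ ℕ._<_ (ℕ.^-identityʳ q) (≡.sym size≡q³) (ℕ.^-monoʳ-< q 1<q {1} {3} (ℕ.s≤s (ℕ.s≤s ℕ.z≤n)))

    open CubicAutomorphism σ σ-+ σ-* σ³ public

    module _ {D E} (σD≡D : Fixed D) (σE≡E : Fixed E) where

      open Linearized (fixed-sub σE≡E σD≡D) σD≡D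

      fPoly≡Λ[T²] : ∀ x → fPoly L q D E x ≡ Λ (T x * T x)
      fPoly≡Λ[T²] x = begin
        P (x ^ (q ℕ.+ 1)) (x ^ (q ℕ.^ 2 ℕ.+ 1)) (x ^ (2 ℕ.* q)) (x ^ (2 ℕ.* q ℕ.^ 2))
          ≡⟨ cong₂ (λ a b → P a b (x ^ (2 ℕ.* q)) (x ^ (2 ℕ.* q ℕ.^ 2))) (^-+ x q 1) x^[q²+1]≡σ²x*x ⟩
        P (σ x * x ^ 1) (σ (σ x) * x ^ 1) (x ^ (2 ℕ.* q)) (x ^ (2 ℕ.* q ℕ.^ 2))
          ≡⟨ cong₂ (P (σ x * x ^ 1) (σ (σ x) * x ^ 1)) x^[2q]≡[σx]² x^[2q²]≡[σ²x]² ⟩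
        P (σ x * x ^ 1) (σ (σ x) * x ^ 1) (σ x ^ 2) (σ (σ x) ^ 2)
          ≡⟨ solve 5 (λ E D x s t →
               E :* x :^ 2 :+ con (ℤ.+ 2) :* (E :- D) :* (s :* x :^ 1) :+ con (ℤ.+ 2) :* D :* (t :* x :^ 1)
                 :+ (E :- D) :* s :^ 2 :+ D :* t :^ 2
               := (E :- D) :* ((x :+ s) :* (x :+ s)) :+ D :* ((x :+ t) :* (x :+ t))) ≡.refl E D x (σ x) (σ (σ x)) ⟩
        (E - D) * (T x * T x) + D * ((x + σ (σ x)) * (x + σ (σ x)))
          ≡⟨ cong (λ y → (E - D) * (T x * T x) + D * y) σ²[T²] ⟨
        Λ (T x * T x)
          ∎
        where
        P : Carrier → Carrier → Carrier → Carrier → Carrier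
        P a b c d = E * x ^ 2 + fromℕ 2 * (E - D) * a + fromℕ 2 * D * b + (E - D) * c + D * d
        x^q²≡σ²x : x ^ (q ℕ.^ 2) ≡ σ (σ x)
        x^q²≡σ²x = ≡.trans (cong (λ m → x ^ (q ℕ.* m)) (ℕ.*-identityʳ q)) (^-* x q q)
        x^[q²+1]≡σ²x*x : x ^ (q ℕ.^ 2 ℕ.+ 1) ≡ σ (σ x) * x ^ 1
        x^[q²+1]≡σ²x*x = ≡.trans (^-+ x (q ℕ.^ 2) 1) (cong (_* x ^ 1) x^q²≡σ²x)
        x^[2q]≡[σx]² : x ^ (2 ℕ.* q) ≡ σ x ^ 2
        x^[2q]≡[σx]² = ≡.trans (cong (x ^_) (ℕ.*-comm 2 q)) (^-* x q 2)
        x^[2q²]≡[σ²x]² : x ^ (2 ℕ.* q ℕ.^ 2) ≡ σ (σ x) ^ 2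
        x^[2q²]≡[σ²x]² = ≡.trans (cong (x ^_) (ℕ.*-comm 2 (q ℕ.^ 2))) (≡.trans (^-* x (q ℕ.^ 2) 2) (cong (_^ 2) x^q²≡σ²x))
        σ²[T²] : σ (σ (T x * T x)) ≡ (x + σ (σ x)) * (x + σ (σ x))
        σ²[T²] = ≡.trans (cong σ (σ-* (T x) (T x))) (≡.trans (σ-* _ _) (cong₂ _*_ (σ²-T x) (σ²-T x)))

open import Data.Nat.Base using (_^_)

theorem3p3 : (q : ℕ) → OddPrimePower q → (L : FiniteField) → FiniteField.size L ≡ q ^ 3 →
    (D E : FiniteField.Carrier L) → FiniteField._^_ L D q ≡ D → FiniteField._^_ L E q ≡ E →
    (FiniteField.Planar L (fPoly L q D E) ⇔ FiniteField._*_ L E (ω L D E) ≢ FiniteField.0# L)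
theorem3p3 q (p , k , p-prime , q≡p^[1+k] , 2∤q) L size≡q³ D E σD≡D σE≡E =
  ⇔-trans (planar⇔Λ-trivialKernel 2≢0 (fPoly≡Λ[T²] σD≡D σE≡E))
    (⇔-trans (Λ-trivialKernel⇔ (proj₂ ∃σw≢w))
      (mk⇔ (≡.subst (_≢ 0#) (≡.sym (E*ω≡[E-D]³+D³ D E))) (≡.subst (_≢ 0#) (E*ω≡[E-D]³+D³ D E))))
  where
  open FieldProperties L
  open Frobenius L {k = k} p-prime q≡p^[1+k] size≡q³
  open Linearized (fixed-sub σE≡E σD≡D) σD≡D
  2≢0 : fromℕ 2 ≢ 0#
  2≢0 = odd-characteristic⇒2≢0 2∤q fromℕ-q≡0
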